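{- Let $G$ be a 2-connected graph and let $G'$ be an even subdivision or an odd expansion of $G$. If $G'$ is claw-free, then $G$ is claw-free.
   Context: Graphs are connected, loopless, possibly with multiple edges. $G$ is claw-free if its underlying simple graph (one edge between each pair of adjacent vertices) has no induced $K_{1,3}$. An even subdivision of $G$ at an edge $e=uv$ is obtained by replacing $e$ by a $uv$-path of odd length at least three with new internal vertices. An odd expansion of $G$ at a vertex $v$ is obtained by: (i) splitting $v$ into two vertices $v'$ and $v''$; (ii) adding a $v'v''$-path $P_v$ of even length at least two (with new internal vertices); (iii) distributing the edges of $G$ incident with $v$ among $v'$ and $v''$ so that each of $v'$, $v''$ has at least one neighbour in $V(G-v)$; and (iv) optionally adding some edges joining $v'$ and $v''$. -}

module Defs where

open import Data.Nat using (ℕ; zero; suc; _*_; _≤_)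
open import Data.Fin using (Fin; zero; suc; inject₁; fromℕ; _≟_)
open import Data.Bool using (Bool; true; false; if_then_else_)
open import Data.Maybe using (Maybe; just; nothing; maybe)
import Data.Maybe as Maybe
open import Data.Product using (Σ; ∃; _×_; _,_; proj₁; proj₂)
open import Data.Sum using (_⊎_; inj₁; inj₂)
open import Data.Empty using (⊥)
open import Relation.Nullary using (¬_; yes; no)
open import Relation.Binary.PropositionalEquality using (_≡_; _≢_)
open import Relation.Binary.Construct.Closure.ReflexiveTransitive using (Star)
open import Function.Bundles using (_↔_; Inverse)

-- A finite loopless multigraph: vertices Fin n, edges Fin m (each edge has
-- its own identity, so parallel edges are allowed), with endpoint map.
record Graph : Set where
  field
    n        : ℕ
    m        : ℕ
    ends     : Fin m → Fin n × Fin n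
    loopless : ∀ e → proj₁ (ends e) ≢ proj₂ (ends e)
open Graph public

SameEnds : {V : Set} → V × V → V × V → Set
SameEnds (a , b) (c , d) = (a ≡ c × b ≡ d) ⊎ (a ≡ d × b ≡ c)

Adj : (G : Graph) → Fin (n G) → Fin (n G) → Set
Adj G x y = ∃ λ e → SameEnds (ends G e) (x , y)

AdjAvoid : (G : Graph) → Fin (n G) → Fin (n G) → Fin (n G) → Set
AdjAvoid G v x y = Adj G x y × x ≢ v × y ≢ v

-- 2-connected: at least 3 vertices and G - v is connected for every v
-- (this also forces G to be connected).
TwoConnected : Graph → Set
TwoConnected G =
  3 ≤ n G ×
  (∀ v a b → a ≢ v → b ≢ v → Star (AdjAvoid G v) a b)

ClawFree : Graph → Set
ClawFree G = ∀ c a b d →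
  Adj G c a → Adj G c b → Adj G c d →
  a ≢ b → a ≢ d → b ≢ d →
  ¬ Adj G a b → ¬ Adj G a d → ¬ Adj G b d → ⊥

IsoTo : (G' : Graph) (V E : Set) → (E → V × V) → Set
IsoTo G' V E en =
  Σ (Fin (n G') ↔ V) λ φ → Σ (Fin (m G') ↔ E) λ ψ →
    ∀ f → SameEnds (Inverse.to φ (proj₁ (ends G' f)) , Inverse.to φ (proj₂ (ends G' f)))
                   (en (Inverse.to ψ f))

-- inner j = just j if j < t, nothing if j is the last element of Fin (suc t).
inner : ∀ {t} → Fin (suc t) → Maybe (Fin t)
inner {zero}  zero    = nothing
inner {suc t} zero    = just zero
inner {suc t} (suc j) = Maybe.map suc (inner j)

-- Even subdivision at edge e = uv: replace e by a uv-path of length t+1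
-- with t new internal vertices (Fin t), where t = 2 * suc j, i.e. the path
-- has odd length ≥ 3.

module Subdiv (G : Graph) (e : Fin (m G)) (t : ℕ) where
  u v : Fin (n G)
  u = proj₁ (ends G e)
  v = proj₂ (ends G e)

  SV : Set
  SV = Fin (n G) ⊎ Fin t

  SE : Set
  SE = (Σ (Fin (m G)) λ f → f ≢ e) ⊎ Fin (suc t)

  -- path vertices 0 .. t+1 ; 0 = u, t+1 = v, k (1 ≤ k ≤ t) = internal k-1
  pv : Fin (suc (suc t)) → SV
  pv zero    = inj₁ u
  pv (suc j) = maybe inj₂ (inj₁ v) (inner j)

  sEnds : SE → SV × SV
  sEnds (inj₁ (f , _)) = inj₁ (proj₁ (ends G f)) , inj₁ (proj₂ (ends G f))
  sEnds (inj₂ i)       = pv (inject₁ i) , pv (suc i)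

EvenSubdivision : Graph → Graph → Set
EvenSubdivision G G' =
  Σ (Fin (m G)) λ e → Σ ℕ λ j →
    IsoTo G' (Subdiv.SV G e (2 * suc j)) (Subdiv.SE G e (2 * suc j))
             (Subdiv.sEnds G e (2 * suc j))

-- Odd expansion at vertex v: v is split into v' and v'' joined by a path
-- P_v of length s = 2 * suc j (even, ≥ 2) on path vertices Fin (suc s),
-- with v' = path vertex 0 and v'' = path vertex s; each edge of G incident
-- with v goes to v' (side = true) or v'' (side = false); r extra edges
-- join v' and v''.

module OddExp (G : Graph) (v : Fin (n G)) (s : ℕ) (side : Fin (m G) → Bool) (r : ℕ) where
  OV : Set
  OV = (Σ (Fin (n G)) λ w → w ≢ v) ⊎ Fin (suc s)

  OE : Set
  OE = Fin (m G) ⊎ (Fin s ⊎ Fin r)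

  v′ v″ : OV
  v′ = inj₂ zero
  v″ = inj₂ (fromℕ s)

  rep : Fin (m G) → Fin (n G) → OV
  rep f x with x ≟ v
  ... | yes _ = if side f then v′ else v″
  ... | no p  = inj₁ (x , p)

  oEnds : OE → OV × OV
  oEnds (inj₁ f)        = rep f (proj₁ (ends G f)) , rep f (proj₂ (ends G f))
  oEnds (inj₂ (inj₁ i)) = inj₂ (inject₁ i) , inj₂ (suc i)
  oEnds (inj₂ (inj₂ _)) = v′ , v″

Incident : (G : Graph) → Fin (n G) → Fin (m G) → Set
Incident G v f = proj₁ (ends G f) ≡ v ⊎ proj₂ (ends G f) ≡ v

OddExpansion : Graph → Graph → Set
OddExpansion G G' =
  Σ (Fin (n G)) λ v → Σ ℕ λ j → Σ (Fin (m G) → Bool) λ side → Σ ℕ λ r →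
    (∃ λ f → Incident G v f × side f ≡ true) ×
    (∃ λ f → Incident G v f × side f ≡ false) ×
    IsoTo G' (OddExp.OV G v (2 * suc j) side r) (OddExp.OE G v (2 * suc j) side r)
             (OddExp.oEnds G v (2 * suc j) side r)

module Submission where

-- Claw-freeness descends from an even subdivision or an odd expansion of G
-- back to G.  We prove the contrapositive: every claw of G yields a claw of
-- the new graph G'.
--
-- A
--     claw (c; a, b, d) lifts unchanged unless {c, a} = {u, v} is joined only
--     by e; then a is replaced by the path vertex next to c, whose only old
--     neighbour is c.
--   * Odd expansion at v: contracting P_v back to v maps G' onto G.  A claw
--     centred at v has two spokes on the same side v' or v''; they form a
--     claw with the next vertex of P_v.  A claw with leaf v uses the end of
--     P_v carrying that spoke instead.

open import Defs
open import Data.Nat using (ℕ; zero; suc; _≤_; _*_; z≤n; s≤s)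
open import Data.Nat.Properties using (suc-injective; *-monoʳ-≤; n≮0)
open import Data.Fin using (Fin; zero; suc; inject₁; fromℕ; toℕ; _≟_)
open import Data.Fin.Properties using (toℕ-inject₁; toℕ-inject₁-≢; toℕ-fromℕ; fromℕ≢inject₁)
open import Data.Bool using (Bool; true; false; if_then_else_)
open import Data.Maybe using (just; nothing; maybe)
open import Data.Product using (Σ; ∃; _×_; _,_; proj₁; proj₂)
open import Data.Sum using (_⊎_; inj₁; inj₂)
open import Data.Sum.Properties using (inj₁-injective)
open import Data.Unit using (⊤; tt)
open import Data.Empty using (⊥; ⊥-elim)
open import Relation.Nullary using (¬_; yes; no)
open import Relation.Binary.PropositionalEquality
open import Function.Bundles using (Inverse)

record Claw {V : Set} (_~_ : V → V → Set) (c a b d : V) : Set where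
  field
    c~a : c ~ a
    c~b : c ~ b
    c~d : c ~ d
    a≢b : a ≢ b
    a≢d : a ≢ d
    b≢d : b ≢ d
    a≁b : ¬ a ~ b
    a≁d : ¬ a ~ d
    b≁d : ¬ b ~ d

HasClaw : {V : Set} → (V → V → Set) → Set
HasClaw {V} _~_ = Σ V λ c → Σ V λ a → Σ V λ b → Σ V λ d → Claw _~_ c a b d

-- Cyclic relabelling of the leaves of a claw in a symmetric relation; it
-- lets every case analysis below inspect the first leaf only.
rotate : {V : Set} {_~_ : V → V → Set} → (∀ {x y} → x ~ y → y ~ x) →
         ∀ {c a b d} → Claw _~_ c a b d → Claw _~_ c b d a
rotate sym~ κ = record
  { c~a = c~b ; c~b = c~d ; c~d = c~a
  ; a≢b = b≢d ; a≢d = λ b≡a → a≢b (sym b≡a) ; b≢d = λ d≡a → a≢d (sym d≡a)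
  ; a≁b = b≁d ; a≁d = λ b~a → a≁b (sym~ b~a) ; b≁d = λ d~a → a≁d (sym~ d~a) }
  where open Claw κ

clawFree-intro : (G : Graph) → ¬ HasClaw (Adj G) → ClawFree G
clawFree-intro G noClaw c a b d c~a c~b c~d a≢b a≢d b≢d a≁b a≁d b≁d =
  noClaw (c , a , b , d , record
    { c~a = c~a ; c~b = c~b ; c~d = c~d ; a≢b = a≢b ; a≢d = a≢d ; b≢d = b≢d
    ; a≁b = a≁b ; a≁d = a≁d ; b≁d = b≁d })

clawFree-elim : {G : Graph} → ClawFree G → ¬ HasClaw (Adj G)
clawFree-elim cf (c , a , b , d , κ) = cf c a b d c~a c~b c~d a≢b a≢d b≢d a≁b a≁d b≁d
  where open Claw κ

record InducedEmbedding {V W : Set} (R : V → V → Set) (S : W → W → Set) (f : V → W) : Set where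
  field
    injective : ∀ {x y} → f x ≡ f y → x ≡ y
    preserves : ∀ {x y} → R x y → S (f x) (f y)
    reflects  : ∀ {x y} → S (f x) (f y) → R x y

mapClaw : {V W : Set} {R : V → V → Set} {S : W → W → Set} {f : V → W} →
          InducedEmbedding R S f → HasClaw R → HasClaw S
mapClaw {f = f} emb (c , a , b , d , κ) = f c , f a , f b , f d , record
  { c~a = preserves c~a ; c~b = preserves c~b ; c~d = preserves c~d
  ; a≢b = λ eq → a≢b (injective eq) ; a≢d = λ eq → a≢d (injective eq)
  ; b≢d = λ eq → b≢d (injective eq)
  ; a≁b = λ s → a≁b (reflects s) ; a≁d = λ s → a≁d (reflects s)
  ; b≁d = λ s → b≁d (reflects s) }
  where open Claw κ
        open InducedEmbedding emb

-- Adjacency in the simple graph underlying en : E → V × V; Adj G is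
-- definitionally Adjacent (ends G).
Adjacent : {V E : Set} → (E → V × V) → V → V → Set
Adjacent en x y = ∃ λ e → SameEnds (en e) (x , y)

module _ {V : Set} where
  SameEnds-flip : {p : V × V} {x y : V} → SameEnds p (x , y) → SameEnds p (y , x)
  SameEnds-flip (inj₁ (p , q)) = inj₂ (p , q)
  SameEnds-flip (inj₂ (p , q)) = inj₁ (p , q)

  SameEnds-sym : {a b x y : V} → SameEnds (a , b) (x , y) → SameEnds (x , y) (a , b)
  SameEnds-sym (inj₁ (p , q)) = inj₁ (sym p , sym q)
  SameEnds-sym (inj₂ (p , q)) = inj₂ (sym q , sym p)

  SameEnds-trans : {a b c d x y : V} → SameEnds (a , b) (c , d) → SameEnds (c , d) (x , y) →
                   SameEnds (a , b) (x , y)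
  SameEnds-trans (inj₁ (p , q)) (inj₁ (r , s)) = inj₁ (trans p r , trans q s)
  SameEnds-trans (inj₁ (p , q)) (inj₂ (r , s)) = inj₂ (trans p r , trans q s)
  SameEnds-trans (inj₂ (p , q)) (inj₁ (r , s)) = inj₂ (trans p s , trans q r)
  SameEnds-trans (inj₂ (p , q)) (inj₂ (r , s)) = inj₁ (trans p s , trans q r)

  otherEnd : {u v c a b : V} → u ≢ v →
             SameEnds (u , v) (c , a) → SameEnds (u , v) (c , b) → a ≡ b
  otherEnd u≢v (inj₁ (p , q)) (inj₁ (r , s)) = trans (sym q) s
  otherEnd u≢v (inj₁ (p , q)) (inj₂ (r , s)) = ⊥-elim (u≢v (trans p (sym s)))
  otherEnd u≢v (inj₂ (p , q)) (inj₁ (r , s)) = ⊥-elim (u≢v (trans r (sym q)))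
  otherEnd u≢v (inj₂ (p , q)) (inj₂ (r , s)) = trans (sym p) r

SameEnds-map : {V W : Set} (g : V → W) {a b x y : V} →
               SameEnds (a , b) (x , y) → SameEnds (g a , g b) (g x , g y)
SameEnds-map g (inj₁ (p , q)) = inj₁ (cong g p , cong g q)
SameEnds-map g (inj₂ (p , q)) = inj₂ (cong g p , cong g q)

SameEnds-unmap : {V W : Set} (g : V → W) → (∀ {x y} → g x ≡ g y → x ≡ y) → {a b x y : V} →
                 SameEnds (g a , g b) (g x , g y) → SameEnds (a , b) (x , y)
SameEnds-unmap g inj (inj₁ (p , q)) = inj₁ (inj p , inj q)
SameEnds-unmap g inj (inj₂ (p , q)) = inj₂ (inj p , inj q)

adjacent-sym : {V E : Set} {en : E → V × V} {x y : V} → Adjacent en x y → Adjacent en y x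
adjacent-sym (e , s) = e , SameEnds-flip s

adjacent-≢ : (G : Graph) {x y : Fin (n G)} → Adj G x y → x ≢ y
adjacent-≢ G (e , inj₁ (p , q)) refl = loopless G e (trans p (sym q))
adjacent-≢ G (e , inj₂ (p , q)) refl = loopless G e (trans p (sym q))

isoEmbedding : (G' : Graph) {V E : Set} {en : E → V × V} (iso : IsoTo G' V E en) →
               InducedEmbedding (Adjacent en) (Adj G') (Inverse.from (proj₁ iso))
isoEmbedding G' {en = en} (φ , ψ , ends≅) = record
  { injective = λ {x} {y} eq →
      trans (sym (to∘from x)) (trans (cong (Inverse.to φ) eq) (to∘from y))
  ; preserves = preserves
  ; reflects  = λ { {x} {y} (f , s) → Inverse.to ψ f , SameEnds-trans (SameEnds-sym (ends≅ f))
                    (subst₂ (λ x′ y′ → SameEnds _ (x′ , y′)) (to∘from x) (to∘from y)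
                            (SameEnds-map (Inverse.to φ) s)) }
  }
  where
  to∘from : ∀ x → Inverse.to φ (Inverse.from φ x) ≡ x
  to∘from = Inverse.strictlyInverseˡ φ

  preserves : ∀ {x y} → Adjacent en x y → Adj G' (Inverse.from φ x) (Inverse.from φ y)
  preserves {x} {y} (e , s) = f , subst₂ (λ a b → SameEnds (a , b) _)
      (Inverse.strictlyInverseʳ φ _) (Inverse.strictlyInverseʳ φ _)
      (SameEnds-map (Inverse.from φ) (SameEnds-trans imageEnds s))
    where
    f : Fin (m G')
    f = Inverse.from ψ e
    imageEnds : SameEnds (Inverse.to φ (proj₁ (ends G' f)) , Inverse.to φ (proj₂ (ends G' f))) (en e)
    imageEnds = subst (λ e′ → SameEnds (Inverse.to φ (proj₁ (ends G' f)) , Inverse.to φ (proj₂ (ends G' f))) (en e′))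
                      (Inverse.strictlyInverseˡ ψ e) (ends≅ f)

clawFree-presentation : (G' : Graph) {V E : Set} {en : E → V × V} →
                        IsoTo G' V E en → ClawFree G' → ¬ HasClaw (Adjacent en)
clawFree-presentation G' iso cf claw = clawFree-elim {G'} cf (mapClaw (isoEmbedding G' iso) claw)

inner-nothing : ∀ {t} (j : Fin (suc t)) → inner j ≡ nothing → toℕ j ≡ t
inner-nothing {zero}  zero    _ = refl
inner-nothing {suc t} zero    ()
inner-nothing {suc t} (suc j) eq with inner j in eq′
... | nothing = cong suc (inner-nothing j eq′)

inner-just : ∀ {t} (j : Fin (suc t)) {k} → inner j ≡ just k → toℕ j ≡ toℕ k
inner-just {zero}  zero    ()
inner-just {suc t} zero    refl = refl
inner-just {suc t} (suc j) eq with inner j in eq′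
inner-just {suc t} (suc j) refl | just _ = cong suc (inner-just j eq′)

inner-inject₁ : ∀ {t} (j : Fin t) → inner (inject₁ j) ≡ just j
inner-inject₁ {suc t} zero    = refl
inner-inject₁ {suc t} (suc j) rewrite inner-inject₁ j = refl

inner-fromℕ : ∀ t → inner (fromℕ t) ≡ nothing
inner-fromℕ zero    = refl
inner-fromℕ (suc t) rewrite inner-fromℕ t = refl

module SubdivisionPath (G : Graph) (e : Fin (m G)) (t : ℕ) where
  open Subdiv G e t

  pv-old : ∀ p {x} → pv p ≡ inj₁ x → (toℕ p ≡ 0 × x ≡ u) ⊎ (toℕ p ≡ suc t × x ≡ v)
  pv-old zero    refl = inj₁ (refl , refl)
  pv-old (suc j) eq with inner j in eq′
  pv-old (suc j) refl | nothing = inj₂ (cong suc (inner-nothing j eq′) , refl)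

  pv-internal : ∀ p {k} → pv p ≡ inj₂ k → toℕ p ≡ suc (toℕ k)
  pv-internal (suc j) eq with inner j in eq′
  pv-internal (suc j) refl | just _ = cong suc (inner-just j eq′)

  mixedAdjacency : ∀ {x k} → Adjacent sEnds (inj₁ x) (inj₂ k) →
                   (x ≡ u × toℕ k ≡ 0) ⊎ (x ≡ v × suc (toℕ k) ≡ t)
  mixedAdjacency (inj₁ _ , inj₁ (_ , ()))
  mixedAdjacency (inj₁ _ , inj₂ (() , _))
  mixedAdjacency (inj₂ i , inj₁ (p , q)) with pv-old (inject₁ i) p
  ... | inj₁ (at0 , x≡u) =
    inj₁ (x≡u , trans (sym (suc-injective (pv-internal (suc i) q))) (trans (sym (toℕ-inject₁ i)) at0))
  ... | inj₂ (atEnd , _) = ⊥-elim (toℕ-inject₁-≢ i (sym atEnd))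
  mixedAdjacency (inj₂ i , inj₂ (p , q)) with pv-old (suc i) q
  ... | inj₁ (() , _)
  ... | inj₂ (atEnd , x≡v) =
    inj₂ (x≡v , trans (sym (pv-internal (inject₁ i) p)) (trans (toℕ-inject₁ i) (suc-injective atEnd)))

  noOldPathEdge : 1 ≤ t → ∀ i {x y} → pv (inject₁ i) ≡ inj₁ x → pv (suc i) ≡ inj₁ y → ⊥
  noOldPathEdge 1≤t i p q with pv-old (inject₁ i) p | pv-old (suc i) q
  ... | inj₂ (atEnd , _) | _            = toℕ-inject₁-≢ i (sym atEnd)
  ... | inj₁ _           | inj₁ (() , _)
  ... | inj₁ (at0 , _)   | inj₂ (atEnd , _) =
    n≮0 (subst (1 ≤_) (trans (sym (suc-injective atEnd)) (trans (sym (toℕ-inject₁ i)) at0)) 1≤t)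

  oldAdjacency : 1 ≤ t → ∀ {x y} → Adjacent sEnds (inj₁ x) (inj₁ y) → Adj G x y
  oldAdjacency _   (inj₁ (f , _) , s)     = f , SameEnds-unmap inj₁ inj₁-injective s
  oldAdjacency 1≤t (inj₂ i , inj₁ (p , q)) = ⊥-elim (noOldPathEdge 1≤t i p q)
  oldAdjacency 1≤t (inj₂ i , inj₂ (p , q)) = ⊥-elim (noOldPathEdge 1≤t i p q)

  liftEdge : ∀ {x y} → Adj G x y → Adjacent sEnds (inj₁ x) (inj₁ y) ⊎ SameEnds (u , v) (x , y)
  liftEdge (f , s) with f ≟ e
  ... | yes refl = inj₂ s
  ... | no f≢e   = inj₁ (inj₁ (f , f≢e) , SameEnds-map inj₁ s)

  -- If {c, a} = {u, v}, any other spoke c–b survives: it cannot be e, which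
  -- already ends at a.
  liftSpoke : ∀ {c a b} → SameEnds (u , v) (c , a) → Adj G c b → a ≢ b →
              Adjacent sEnds (inj₁ c) (inj₁ b)
  liftSpoke s c~b a≢b with liftEdge c~b
  ... | inj₁ lifted = lifted
  ... | inj₂ s′     = ⊥-elim (a≢b (otherEnd (loopless G e) s s′))

module SubdivisionClaws (G : Graph) (e : Fin (m G)) (k : ℕ) where
  open Subdiv G e (suc (suc k))
  open SubdivisionPath G e (suc (suc k))

  1≤t : 1 ≤ suc (suc k)
  1≤t = s≤s z≤n

  -- Each end c of e has a private neighbour on the path: an internal vertex
  -- adjacent to c and to no other old vertex.  This needs t ≥ 2.
  privateNeighbour : ∀ {c a} → SameEnds (u , v) (c , a) →
    Σ (Fin (suc (suc k))) λ p →
      Adjacent sEnds (inj₁ c) (inj₂ p) × (∀ {x} → Adjacent sEnds (inj₁ x) (inj₂ p) → x ≡ c)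
  privateNeighbour {c} (inj₁ (u≡c , _)) = zero , (inj₂ zero , inj₁ (cong inj₁ u≡c , refl)) , onlyC
    where
    onlyC : ∀ {x} → Adjacent sEnds (inj₁ x) (inj₂ zero) → x ≡ c
    onlyC x~p with mixedAdjacency x~p
    ... | inj₁ (x≡u , _) = trans x≡u u≡c
    ... | inj₂ (_ , ())
  privateNeighbour {c} (inj₂ (_ , v≡c)) =
    fromℕ (suc k) , (inj₂ (fromℕ (suc (suc k))) , inj₂ (nextToEnd , atEnd)) , onlyC
    where
    nextToEnd : pv (inject₁ (fromℕ (suc (suc k)))) ≡ inj₂ (fromℕ (suc k))
    nextToEnd = cong (maybe inj₂ (inj₁ v)) (inner-inject₁ (fromℕ (suc k)))
    atEnd : pv (suc (fromℕ (suc (suc k)))) ≡ inj₁ c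
    atEnd = trans (cong (maybe inj₂ (inj₁ v)) (inner-fromℕ (suc (suc k)))) (cong inj₁ v≡c)
    onlyC : ∀ {x} → Adjacent sEnds (inj₁ x) (inj₂ (fromℕ (suc k))) → x ≡ c
    onlyC x~p with mixedAdjacency x~p
    ... | inj₂ (x≡v , _) = trans x≡v v≡c
    ... | inj₁ (_ , at0) with trans (sym (toℕ-fromℕ (suc k))) at0
    ... | ()

  -- A claw whose spoke c–a is the subdivided edge: replace the leaf a by the
  -- private neighbour of c.
  endClaw : ∀ {c a b d} → SameEnds (u , v) (c , a) → Claw (Adj G) c a b d →
            HasClaw (Adjacent sEnds)
  endClaw {c} {a} {b} {d} s κ with privateNeighbour s
  ... | p , c~p , onlyC = inj₁ c , inj₂ p , inj₁ b , inj₁ d , record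
    { c~a = c~p ; c~b = liftSpoke s c~b a≢b ; c~d = liftSpoke s c~d a≢d
    ; a≢b = λ () ; a≢d = λ () ; b≢d = λ eq → b≢d (inj₁-injective eq)
    ; a≁b = λ p~b → adjacent-≢ G c~b (sym (onlyC (adjacent-sym p~b)))
    ; a≁d = λ p~d → adjacent-≢ G c~d (sym (onlyC (adjacent-sym p~d)))
    ; b≁d = λ b~d → b≁d (oldAdjacency 1≤t b~d) }
    where open Claw κ

  liftClaw : HasClaw (Adj G) → HasClaw (Adjacent sEnds)
  liftClaw (c , a , b , d , κ) with liftEdge (Claw.c~a κ) | liftEdge (Claw.c~b κ) | liftEdge (Claw.c~d κ)
  ... | inj₂ s | _      | _      = endClaw s κ
  ... | _      | inj₂ s | _      = endClaw s (rotate adjacent-sym κ)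
  ... | _      | _      | inj₂ s = endClaw s (rotate adjacent-sym (rotate adjacent-sym κ))
  ... | inj₁ c~a | inj₁ c~b | inj₁ c~d = inj₁ c , inj₁ a , inj₁ b , inj₁ d , record
    { c~a = c~a ; c~b = c~b ; c~d = c~d
    ; a≢b = λ eq → a≢b (inj₁-injective eq) ; a≢d = λ eq → a≢d (inj₁-injective eq)
    ; b≢d = λ eq → b≢d (inj₁-injective eq)
    ; a≁b = λ x → a≁b (oldAdjacency 1≤t x) ; a≁d = λ x → a≁d (oldAdjacency 1≤t x)
    ; b≁d = λ x → b≁d (oldAdjacency 1≤t x) }
    where open Claw κ hiding (c~a; c~b; c~d)

subdivisionClaw : (G : Graph) (e : Fin (m G)) (t : ℕ) → 2 ≤ t →
                  HasClaw (Adj G) → HasClaw (Adjacent (Subdiv.sEnds G e t))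
subdivisionClaw G e (suc (suc k)) (s≤s (s≤s z≤n)) = SubdivisionClaws.liftClaw G e k

module OddExpansionStructure (G : Graph) (v : Fin (n G)) (s : ℕ)
                             (side : Fin (m G) → Bool) (r : ℕ) where
  open OddExp G v s side r

  OnPath : OV → Set
  OnPath (inj₁ _) = ⊥
  OnPath (inj₂ _) = ⊤

  base : OV → Fin (n G)
  base (inj₁ (w , _)) = w
  base (inj₂ _)       = v

  base-path : ∀ {w} → OnPath w → base w ≡ v
  base-path {inj₂ _} _ = refl

  S : Bool → OV
  S σ = if σ then v′ else v″

  S-onPath : ∀ σ → OnPath (S σ)
  S-onPath true  = tt
  S-onPath false = tt

  -- Old vertices of G'.
  ι : Fin (n G) → OV
  ι x with x ≟ v
  ... | yes _   = v′
  ... | no x≢v  = inj₁ (x , x≢v)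

  base-ι : ∀ x → base (ι x) ≡ x
  base-ι x with x ≟ v
  ... | yes x≡v = sym x≡v
  ... | no _    = refl

  ι-injective : ∀ {x y} → ι x ≡ ι y → x ≡ y
  ι-injective {x} {y} eq = trans (sym (base-ι x)) (trans (cong base eq) (base-ι y))

  ι-old : ∀ {x} → x ≢ v → ¬ OnPath (ι x)
  ι-old {x} x≢v with x ≟ v
  ... | yes x≡v = ⊥-elim (x≢v x≡v)
  ... | no _    = λ ()

  S≢ι : ∀ σ {y} → y ≢ v → S σ ≢ ι y
  S≢ι σ {y} y≢v eq = y≢v (trans (sym (base-ι y)) (trans (sym (cong base eq)) (base-path (S-onPath σ))))

  rep-ι : ∀ f {x} → x ≢ v → rep f x ≡ ι x
  rep-ι f {x} x≢v with x ≟ v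
  ... | yes x≡v = ⊥-elim (x≢v x≡v)
  ... | no _    = refl

  rep-v : ∀ f → rep f v ≡ S (side f)
  rep-v f with v ≟ v
  ... | yes _  = refl
  ... | no v≢v = ⊥-elim (v≢v refl)

  base-rep : ∀ f x → base (rep f x) ≡ x
  base-rep f x with x ≟ v
  ... | yes x≡v = trans (base-path (S-onPath (side f))) (sym x≡v)
  ... | no _    = refl

  rep-path : ∀ f x {k} → rep f x ≡ inj₂ k → k ≡ zero ⊎ k ≡ fromℕ s
  rep-path f x eq with x ≟ v
  ... | yes _ = S-end (side f) eq
    where
    S-end : ∀ σ {k} → S σ ≡ inj₂ k → k ≡ zero ⊎ k ≡ fromℕ s
    S-end true  refl = inj₁ refl
    S-end false refl = inj₂ refl

  bothOnPath : ∀ {i j w w′} → SameEnds (inj₂ i , inj₂ j) (w , w′) → OnPath w × OnPath w′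
  bothOnPath (inj₁ (refl , refl)) = tt , tt
  bothOnPath (inj₂ (refl , refl)) = tt , tt

  contract : ∀ {w w′} → Adjacent oEnds w w′ → (OnPath w × OnPath w′) ⊎ Adj G (base w) (base w′)
  contract (inj₁ f , ends≡) =
    inj₂ (f , subst₂ (λ a b → SameEnds (a , b) _) (base-rep f _) (base-rep f _) (SameEnds-map base ends≡))
  contract (inj₂ (inj₁ _) , ends≡) = inj₁ (bothOnPath ends≡)
  contract (inj₂ (inj₂ _) , ends≡) = inj₁ (bothOnPath ends≡)

  nonadjacent : ∀ {w x y} → base w ≡ x → y ≢ v → ¬ Adj G x y → ¬ Adjacent oEnds w (ι y)
  nonadjacent {y = y} refl y≢v x≁y w~y with contract w~y
  ... | inj₁ (_ , onPath) = ι-old y≢v onPath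
  ... | inj₂ adj          = x≁y (subst (Adj G _) (base-ι y) adj)

  endsOnly : ∀ {w k} → ¬ OnPath w → Adjacent oEnds w (inj₂ k) → k ≡ zero ⊎ k ≡ fromℕ s
  endsOnly _   (inj₁ f , inj₁ (_ , q)) = rep-path f (proj₂ (ends G f)) q
  endsOnly _   (inj₁ f , inj₂ (p , _)) = rep-path f (proj₁ (ends G f)) p
  endsOnly off (inj₂ (inj₁ _) , ends≡) = ⊥-elim (off (proj₁ (bothOnPath ends≡)))
  endsOnly off (inj₂ (inj₂ _) , ends≡) = ⊥-elim (off (proj₁ (bothOnPath ends≡)))

  liftOld : ∀ {x y} → x ≢ v → y ≢ v → Adj G x y → Adjacent oEnds (ι x) (ι y)
  liftOld x≢v y≢v (f , ends≡) =
    subst₂ (Adjacent oEnds) (rep-ι f x≢v) (rep-ι f y≢v) (inj₁ f , SameEnds-map (rep f) ends≡)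

  sideOf : ∀ {x y} → Adj G x y → Bool
  sideOf (f , _) = side f

  liftAtV : ∀ {y} (v~y : Adj G v y) → y ≢ v → Adjacent oEnds (S (sideOf v~y)) (ι y)
  liftAtV (f , ends≡) y≢v =
    subst₂ (Adjacent oEnds) (rep-v f) (rep-ι f y≢v) (inj₁ f , SameEnds-map (rep f) ends≡)

twoAgree : (x y z : Bool) → x ≡ y ⊎ y ≡ z ⊎ z ≡ x
twoAgree false false _     = inj₁ refl
twoAgree true  true  _     = inj₁ refl
twoAgree false true  true  = inj₂ (inj₁ refl)
twoAgree true  false false = inj₂ (inj₁ refl)
twoAgree false true  false = inj₂ (inj₂ refl)
twoAgree true  false true  = inj₂ (inj₂ refl)

module OddExpansionClaws (G : Graph) (v : Fin (n G)) (s′ : ℕ)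
                         (side : Fin (m G) → Bool) (r : ℕ) where
  open OddExp G v (suc (suc s′)) side r
  open OddExpansionStructure G v (suc (suc s′)) side r

  -- The neighbour of the end S σ along P_v; it is internal as s ≥ 2.
  P : Bool → OV
  P true  = inj₂ (suc zero)
  P false = inj₂ (inject₁ (fromℕ (suc s′)))

  S~P : ∀ σ → Adjacent oEnds (S σ) (P σ)
  S~P true  = inj₂ (inj₁ zero) , inj₁ (refl , refl)
  S~P false = inj₂ (inj₁ (fromℕ (suc s′))) , inj₂ (refl , refl)

  ι≁P : ∀ σ {x} → x ≢ v → ¬ Adjacent oEnds (ι x) (P σ)
  ι≁P true  x≢v x~P with endsOnly (ι-old x≢v) x~P
  ... | inj₁ ()
  ... | inj₂ ()
  ι≁P false x≢v x~P with endsOnly (ι-old x≢v) x~P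
  ... | inj₁ ()
  ... | inj₂ eq = fromℕ≢inject₁ (sym eq)

  ι≢P : ∀ σ {x} → x ≢ v → ι x ≢ P σ
  ι≢P σ x≢v eq = ι-old x≢v (subst OnPath (sym eq) (P-onPath σ))
    where
    P-onPath : ∀ σ → OnPath (P σ)
    P-onPath true  = tt
    P-onPath false = tt

  -- A claw centred at v whose spokes to a and b lie on the same side σ:
  -- S σ with a, b and the next vertex P σ of P_v.
  centreClaw : ∀ {a b d} (κ : Claw (Adj G) v a b d) →
               sideOf (Claw.c~a κ) ≡ sideOf (Claw.c~b κ) → HasClaw (Adjacent oEnds)
  centreClaw {a} {b} κ sameSide = S σ , ι a , ι b , P σ , record
    { c~a = liftAtV c~a a≢v
    ; c~b = subst (λ σ′ → Adjacent oEnds (S σ′) (ι b)) (sym sameSide) (liftAtV c~b b≢v)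
    ; c~d = S~P σ
    ; a≢b = λ eq → a≢b (ι-injective eq) ; a≢d = ι≢P σ a≢v ; b≢d = ι≢P σ b≢v
    ; a≁b = nonadjacent (base-ι a) b≢v a≁b ; a≁d = ι≁P σ a≢v ; b≁d = ι≁P σ b≢v }
    where
    open Claw κ
    σ : Bool
    σ = sideOf c~a
    a≢v : a ≢ v
    a≢v a≡v = adjacent-≢ G c~a (sym a≡v)
    b≢v : b ≢ v
    b≢v b≡v = adjacent-≢ G c~b (sym b≡v)

  -- A claw with leaf v: replace v by the end of P_v carrying the spoke.
  leafClaw : ∀ {c b d} → c ≢ v → Claw (Adj G) c v b d → HasClaw (Adjacent oEnds)
  leafClaw {c} {b} {d} c≢v κ = ι c , S σ , ι b , ι d , record
    { c~a = adjacent-sym (liftAtV (adjacent-sym c~a) c≢v)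
    ; c~b = liftOld c≢v b≢v c~b ; c~d = liftOld c≢v d≢v c~d
    ; a≢b = S≢ι σ b≢v ; a≢d = S≢ι σ d≢v ; b≢d = λ eq → b≢d (ι-injective eq)
    ; a≁b = nonadjacent (base-path (S-onPath σ)) b≢v a≁b
    ; a≁d = nonadjacent (base-path (S-onPath σ)) d≢v a≁d
    ; b≁d = nonadjacent (base-ι b) d≢v b≁d }
    where
    open Claw κ
    σ : Bool
    σ = sideOf (adjacent-sym c~a)
    b≢v : b ≢ v
    b≢v b≡v = a≢b (sym b≡v)
    d≢v : d ≢ v
    d≢v d≡v = a≢d (sym d≡v)

  oldClaw : ∀ {c a b d} → c ≢ v → a ≢ v → b ≢ v → d ≢ v → Claw (Adj G) c a b d →
            HasClaw (Adjacent oEnds)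
  oldClaw {c} {a} {b} {d} c≢v a≢v b≢v d≢v κ = ι c , ι a , ι b , ι d , record
    { c~a = liftOld c≢v a≢v c~a ; c~b = liftOld c≢v b≢v c~b ; c~d = liftOld c≢v d≢v c~d
    ; a≢b = λ eq → a≢b (ι-injective eq) ; a≢d = λ eq → a≢d (ι-injective eq)
    ; b≢d = λ eq → b≢d (ι-injective eq)
    ; a≁b = nonadjacent (base-ι a) b≢v a≁b ; a≁d = nonadjacent (base-ι a) d≢v a≁d
    ; b≁d = nonadjacent (base-ι b) d≢v b≁d }
    where open Claw κ

  liftClaw : HasClaw (Adj G) → HasClaw (Adjacent oEnds)
  liftClaw (c , a , b , d , κ) with c ≟ v
  ... | yes refl with twoAgree (sideOf (Claw.c~a κ)) (sideOf (Claw.c~b κ)) (sideOf (Claw.c~d κ))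
  ...   | inj₁ ab        = centreClaw κ ab
  ...   | inj₂ (inj₁ bd) = centreClaw (rotate adjacent-sym κ) bd
  ...   | inj₂ (inj₂ da) = centreClaw (rotate adjacent-sym (rotate adjacent-sym κ)) da
  liftClaw (c , a , b , d , κ) | no c≢v with a ≟ v | b ≟ v | d ≟ v
  ... | yes refl | _        | _        = leafClaw c≢v κ
  ... | _        | yes refl | _        = leafClaw c≢v (rotate adjacent-sym κ)
  ... | _        | _        | yes refl = leafClaw c≢v (rotate adjacent-sym (rotate adjacent-sym κ))
  ... | no a≢v   | no b≢v   | no d≢v   = oldClaw c≢v a≢v b≢v d≢v κ

oddExpansionClaw : (G : Graph) (v : Fin (n G)) (s : ℕ) (side : Fin (m G) → Bool) (r : ℕ) → 2 ≤ s →
                   HasClaw (Adj G) → HasClaw (Adjacent (OddExp.oEnds G v s side r))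
oddExpansionClaw G v (suc (suc s′)) side r (s≤s (s≤s z≤n)) = OddExpansionClaws.liftClaw G v s′ side r

2≤2*suc : ∀ j → 2 ≤ 2 * suc j
2≤2*suc j = *-monoʳ-≤ 2 (s≤s z≤n)

lemma2p7 : (G G' : Graph) → TwoConnected G →
    EvenSubdivision G G' ⊎ OddExpansion G G' →
    ClawFree G' → ClawFree G
lemma2p7 G G' _ (inj₁ (e , j , iso)) clawFree′ = clawFree-intro G λ claw →
  clawFree-presentation G' iso clawFree′ (subdivisionClaw G e (2 * suc j) (2≤2*suc j) claw)
lemma2p7 G G' _ (inj₂ (v , j , side , r , _ , _ , iso)) clawFree′ = clawFree-intro G λ claw →
  clawFree-presentation G' iso clawFree′ (oddExpansionClaw G v (2 * suc j) side r (2≤2*suc j) claw)
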